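{- Let $P$ be an integer pyramid with vertex at the origin $O$ and a triangular base, let $C$ be the cone with vertex at the origin defined by $P$, and let $d>0$ be a real number. Then there are only finitely many integer planes at integer distance at most $d$ from $O$ that divide $C$ into two nonempty parts such that one of these parts is bounded and contains $P$.
   Context: A point is integer if its coordinates are integers; an integer pyramid with vertex $O$ and triangular base is a tetrahedron with vertices $O$ and three integer points not coplanar with $O$; $C$ is the cone $\{\lambda_1v_1+\lambda_2v_2+\lambda_3v_3:\lambda_i\ge0\}$ where $v_1,v_2,v_3$ are the base vertices. A plane is integer if its intersection with $\mathbb Z^3$ is a two-dimensional lattice. For an integer plane $\pi$ and an integer point $A\notin\pi$, the integer distance $\mathrm{Id}(A,\pi)$ is the index of the sublattice generated by all integer vectors from $A$ to integer points of $\pi$ in the lattice of all integer vectors of $\mathbb R^3$ (equivalently, the number of integer planes parallel to $\pi$ between $A$ and $\pi$, counted appropriately; if $\pi=\{a\cdot u=b\}$ with $a$ a primitive integer vector, $\mathrm{Id}(O,\pi)=|b|$). -}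

module Defs where

open import Data.Nat using (ℕ)
open import Data.Nat.Divisibility using (_∣_)
open import Data.Integer as ℤ using (ℤ; ∣_∣)
open import Data.Rational as ℚ using (ℚ; 0ℚ; 1ℚ; _≤_; _<_; _+_; _*_)
open import Data.Product using (_×_; _,_; ∃; ∃-syntax)
open import Data.Sum using (_⊎_)
open import Relation.Binary.PropositionalEquality using (_≡_)

-- Integer vectors of ℤ³ and (rational) points of ℝ³.
Vℤ : Set
Vℤ = ℤ × ℤ × ℤ

Vℚ : Set
Vℚ = ℚ × ℚ × ℚ

toℚ : Vℤ → Vℚ
toℚ (x , y , z) = (ℚ._/_ x 1 , ℚ._/_ y 1 , ℚ._/_ z 1)

_+ᵥ_ : Vℚ → Vℚ → Vℚ
(x , y , z) +ᵥ (x' , y' , z') = (x + x' , y + y' , z + z')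

_·ᵥ_ : ℚ → Vℚ → Vℚ
c ·ᵥ (x , y , z) = (c * x , c * y , c * z)

dot : Vℤ → Vℚ → ℚ
dot a x with toℚ a
... | (a₁ , a₂ , a₃) with x
...   | (x₁ , x₂ , x₃) = a₁ * x₁ + a₂ * x₂ + a₃ * x₃

det : Vℤ → Vℤ → Vℤ → ℤ
det (a , b , c) (d , e , f) (g , h , i) =
  ℤ._-_ (ℤ._+_ (ℤ._*_ a (ℤ._-_ (ℤ._*_ e i) (ℤ._*_ f h)))
               (ℤ._*_ c (ℤ._-_ (ℤ._*_ d h) (ℤ._*_ e g))))
        (ℤ._*_ b (ℤ._-_ (ℤ._*_ d i) (ℤ._*_ f g)))

NonCoplanar : Vℤ → Vℤ → Vℤ → Set
NonCoplanar u v w = ¬ (det u v w ≡ ℤ.0ℤ)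
  where open import Relation.Nullary using (¬_)

InCone : Vℤ → Vℤ → Vℤ → Vℚ → Set
InCone v₁ v₂ v₃ x = ∃[ l₁ ] ∃[ l₂ ] ∃[ l₃ ]
  ((0ℚ ≤ l₁) × (0ℚ ≤ l₂) × (0ℚ ≤ l₃) ×
   (x ≡ ((l₁ ·ᵥ toℚ v₁) +ᵥ (l₂ ·ᵥ toℚ v₂)) +ᵥ (l₃ ·ᵥ toℚ v₃)))

InPyramid : Vℤ → Vℤ → Vℤ → Vℚ → Set
InPyramid v₁ v₂ v₃ x = ∃[ l₁ ] ∃[ l₂ ] ∃[ l₃ ]
  ((0ℚ ≤ l₁) × (0ℚ ≤ l₂) × (0ℚ ≤ l₃) × (l₁ + l₂ + l₃ ≤ 1ℚ) ×
   (x ≡ ((l₁ ·ᵥ toℚ v₁) +ᵥ (l₂ ·ᵥ toℚ v₂)) +ᵥ (l₃ ·ᵥ toℚ v₃)))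

NonEmpty : (Vℚ → Set) → Set
NonEmpty S = ∃[ x ] S x

Bounded : (Vℚ → Set) → Set
Bounded S = ∃[ M ] (∀ x → S x → let (x₁ , x₂ , x₃) = x in
  (ℚ.∣ x₁ ∣ ≤ M) × (ℚ.∣ x₂ ∣ ≤ M) × (ℚ.∣ x₃ ∣ ≤ M))

_⊆_ : (Vℚ → Set) → (Vℚ → Set) → Set
S ⊆ T = ∀ x → S x → T x

-- An integer plane is { x : a·x = b } with a a primitive integer vector
-- and b ∈ ℤ; its integer distance from O is ∣ b ∣.
Primitive : Vℤ → Set
Primitive (a₁ , a₂ , a₃) =
  ∀ (k : ℕ) → k ∣ (∣ a₁ ∣) → k ∣ (∣ a₂ ∣) → k ∣ (∣ a₃ ∣) → k ≡ 1

IntDistO : Vℤ → ℤ → ℕ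
IntDistO a b = ∣ b ∣

-- The plane a·x = b divides C into two nonempty parts (points of C strictly
-- on either side exist), and one of the two parts (closed half-cones)
-- is bounded and contains P.
CutsOffPyramid : Vℤ → Vℤ → Vℤ → Vℤ → ℤ → Set
CutsOffPyramid v₁ v₂ v₃ a b =
  NonEmpty (λ x → InCone v₁ v₂ v₃ x × (dot a x < bq)) ×
  NonEmpty (λ x → InCone v₁ v₂ v₃ x × (bq < dot a x)) ×
  ((Bounded Lo × (InPyramid v₁ v₂ v₃ ⊆ Lo)) ⊎
   (Bounded Hi × (InPyramid v₁ v₂ v₃ ⊆ Hi)))
  where
  bq : ℚ
  bq = ℚ._/_ b 1
  Lo : Vℚ → Set
  Lo x = InCone v₁ v₂ v₃ x × (dot a x ≤ bq)
  Hi : Vℚ → Set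
  Hi x = InCone v₁ v₂ v₃ x × (bq ≤ dot a x)

-- Let cᵢ = a ∙ vᵢ be the values of the linear form a at the vertices. The bounded part of C
-- containing P contains O, so (up to the symmetric case) it is the half-cone a ∙ x ≤ b with
-- b ≥ 0. It contains every vertex, so cᵢ ≤ b; and cᵢ ≥ 0, for otherwise it would contain the
-- whole edge ray of C through vᵢ. Hence ∣ cᵢ ∣ ≤ ∣ b ∣ ≤ d, and as v₁, v₂, v₃ are linearly
-- independent, Cramer's rule recovers a from (c₁, c₂, c₃): only finitely many (a, b) remain.
module Submission where

open import Defs
open import Data.Nat using (ℕ; _≤_)
open import Data.Integer using (ℤ)
open import Data.Product using (_×_; _,_; ∃-syntax)
open import Data.List using (List)
open import Data.List.Membership.Propositional using (_∈_)

open import Data.Nat as ℕ using (suc; z≤n; s≤s)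
import Data.Nat.Properties as ℕₚ
open import Data.Nat.Coprimality using (1-coprimeTo)
import Data.Nat.Coprimality as Coprime
open import Data.Integer as ℤ using (+_; -[1+_]; 0ℤ; ∣_∣; NonZero; +≤+; -≤+; -≤-; _*_; _-_; _+_; -_)
import Data.Integer.Properties as ℤₚ
open import Data.Integer.DivMod using (a≡a%n+[a/n]*n; n%d<d)
open import Data.Integer.Tactic.RingSolver using (solve-∀; solve)
open import Data.Rational as ℚ using (ℚ; mkℚ; 0ℚ; 1ℚ)
import Data.Rational.Properties as ℚₚ
import Data.Rational.Solver as ℚ-Solver
open import Data.Product using (proj₁; proj₂)
open import Data.Sum using (inj₁; inj₂)
open import Data.List using ([]; _∷_; map; upTo; _++_; cartesianProduct)
open import Data.List.Membership.Propositional.Properties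
  using (∈-map⁺; ∈-++⁺ˡ; ∈-++⁺ʳ; ∈-upTo⁺; ∈-cartesianProduct⁺)
open import Data.Empty using (⊥-elim)
open import Function using (_∘_)
open import Relation.Nullary using (¬_; yes; no)
open import Relation.Binary.PropositionalEquality

fromℤ : ℤ → ℚ
fromℤ i = ℚ._/_ i 1

fromℤ≡mkℚ : ∀ i → fromℤ i ≡ mkℚ i 0 (Coprime.sym (1-coprimeTo ∣ i ∣))
fromℤ≡mkℚ (+ n)    = ℚₚ.normalize-coprime (Coprime.sym (1-coprimeTo n))
fromℤ≡mkℚ -[1+ n ] = cong ℚ.-_ (ℚₚ.normalize-coprime (Coprime.sym (1-coprimeTo (suc n))))

fromℤ-* : ∀ i j → fromℤ (i * j) ≡ fromℤ i ℚ.* fromℤ j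
fromℤ-* i j rewrite fromℤ≡mkℚ i | fromℤ≡mkℚ j = refl

fromℤ-+ : ∀ i j → fromℤ (i + j) ≡ fromℤ i ℚ.+ fromℤ j
fromℤ-+ i j rewrite fromℤ≡mkℚ i | fromℤ≡mkℚ j =
  cong (λ k → ℚ._/_ k 1) (cong₂ _+_ (sym (ℤₚ.*-identityʳ i)) (sym (ℤₚ.*-identityʳ j)))

fromℤ-mono-≤ : ∀ {i j} → i ℤ.≤ j → fromℤ i ℚ.≤ fromℤ j
fromℤ-mono-≤ {i} {j} i≤j rewrite fromℤ≡mkℚ i | fromℤ≡mkℚ j =
  ℚ.*≤* (subst₂ ℤ._≤_ (sym (ℤₚ.*-identityʳ i)) (sym (ℤₚ.*-identityʳ j)) i≤j)

fromℤ-cancel-≤ : ∀ {i j} → fromℤ i ℚ.≤ fromℤ j → i ℤ.≤ j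
fromℤ-cancel-≤ {i} {j} i≤j rewrite fromℤ≡mkℚ i | fromℤ≡mkℚ j with i≤j
... | ℚ.*≤* i*1≤j*1 = subst₂ ℤ._≤_ (ℤₚ.*-identityʳ i) (ℤₚ.*-identityʳ j) i*1≤j*1

∣fromℤ∣ : ∀ i → ℚ.∣ fromℤ i ∣ ≡ fromℤ (+ ∣ i ∣)
∣fromℤ∣ i rewrite fromℤ≡mkℚ i | fromℤ≡mkℚ (+ ∣ i ∣) = refl

i≤+∣i∣ : ∀ i → i ℤ.≤ + ∣ i ∣
i≤+∣i∣ (+ n)    = ℤₚ.≤-refl
i≤+∣i∣ -[1+ n ] = -≤+

archimedean : ∀ p → p ℚ.< fromℤ (+ suc ∣ ℚ.↥ p ∣)
archimedean (mkℚ n d _) rewrite fromℤ≡mkℚ (+ suc ∣ n ∣) =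
  ℚ.*<* (subst (ℤ._< + suc ∣ n ∣ * + suc d) (sym (ℤₚ.*-identityʳ n))
    (ℤₚ.≤-<-trans (i≤+∣i∣ n) (ℤ.+<+ (ℕₚ.m≤m*n (suc ∣ n ∣) (suc d)))))

0ℚ≤1ℚ : 0ℚ ℚ.≤ 1ℚ
0ℚ≤1ℚ = ℚₚ.nonNegative⁻¹ 1ℚ

n*i/n≡i : ∀ n i .{{_ : NonZero n}} → n * i ℤ./ n ≡ i
n*i/n≡i n i = sym (ℤₚ.i-j≡0⇒i≡j i q (ℤₚ.∣i∣≡0⇒i≡0 ∣i-q∣≡0))
  where
  q = n * i ℤ./ n
  [i-q]*n≡r : ∀ i q n r → n * i ≡ r + q * n → (i - q) * n ≡ r
  [i-q]*n≡r i q n r n*i≡r+q*n = begin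
    (i - q) * n           ≡⟨ solve (i ∷ q ∷ n ∷ []) ⟩
    n * i - q * n         ≡⟨ cong (_- q * n) n*i≡r+q*n ⟩
    (r + q * n) - q * n   ≡⟨ solve (r ∷ q ∷ n ∷ []) ⟩
    r                     ∎
    where open ≡-Reasoning
  ∣i-q∣*∣n∣≡r : ∣ i - q ∣ ℕ.* ∣ n ∣ ≡ n * i ℤ.% n
  ∣i-q∣*∣n∣≡r = trans (sym (ℤₚ.abs-* (i - q) n))
    (cong ∣_∣ ([i-q]*n≡r i q n (+ (n * i ℤ.% n)) (a≡a%n+[a/n]*n (n * i) n)))
  ∣i-q∣*∣n∣<∣n∣ : ∣ i - q ∣ ℕ.* ∣ n ∣ ℕ.< 1 ℕ.* ∣ n ∣
  ∣i-q∣*∣n∣<∣n∣ = subst₂ ℕ._<_ (sym ∣i-q∣*∣n∣≡r) (sym (ℕₚ.*-identityˡ ∣ n ∣)) (n%d<d (n * i) n)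
  ∣i-q∣≡0 : ∣ i - q ∣ ≡ 0
  ∣i-q∣≡0 = ℕₚ.n<1⇒n≡0 (ℕₚ.*-cancelʳ-< ∣ n ∣ ∣ i - q ∣ 1 ∣i-q∣*∣n∣<∣n∣)

infix  8 _∙_ _⨯_
infixr 7 _⊛_
infixl 6 _⊕_

_∙_ : Vℤ → Vℤ → ℤ
(a₁ , a₂ , a₃) ∙ (x₁ , x₂ , x₃) = a₁ * x₁ + a₂ * x₂ + a₃ * x₃

_⨯_ : Vℤ → Vℤ → Vℤ
(p , q , r) ⨯ (s , t , u) = (q * u - r * t , r * s - p * u , p * t - q * s)

_⊛_ : ℤ → Vℤ → Vℤ
k ⊛ (x , y , z) = (k * x , k * y , k * z)

_⊕_ : Vℤ → Vℤ → Vℤ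
(x , y , z) ⊕ (x′ , y′ , z′) = (x + x′ , y + y′ , z + z′)

_⊘_ : Vℤ → (k : ℤ) .{{_ : NonZero k}} → Vℤ
(x , y , z) ⊘ k = (x ℤ./ k , y ℤ./ k , z ℤ./ k)

0ℤ³ : Vℤ
0ℤ³ = (0ℤ , 0ℤ , 0ℤ)

⊛-⊘-cancel : ∀ k v .{{_ : NonZero k}} → (k ⊛ v) ⊘ k ≡ v
⊛-⊘-cancel k (x , y , z) = cong₂ _,_ (n*i/n≡i k x) (cong₂ _,_ (n*i/n≡i k y) (n*i/n≡i k z))

-- The adjugate of the matrix with rows v₁, v₂, v₃ has columns v₂ ⨯ v₃, v₃ ⨯ v₁, v₁ ⨯ v₂.
cross-expansion : ∀ a v₁ v₂ v₃ →
  a ∙ v₁ ⊛ v₂ ⨯ v₃ ⊕ a ∙ v₂ ⊛ v₃ ⨯ v₁ ⊕ a ∙ v₃ ⊛ v₁ ⨯ v₂ ≡ det v₁ v₂ v₃ ⊛ a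
cross-expansion (a₁ , a₂ , a₃) (p , q , r) (s , t , u) (x , y , z) =
  cong₂ _,_ (first a₁ a₂ a₃ p q r s t u x y z)
    (cong₂ _,_ (second a₁ a₂ a₃ p q r s t u x y z) (third a₁ a₂ a₃ p q r s t u x y z))
  where
  first : ∀ a₁ a₂ a₃ p q r s t u x y z →
    (a₁ * p + a₂ * q + a₃ * r) * (t * z - u * y) + (a₁ * s + a₂ * t + a₃ * u) * (y * r - z * q)
      + (a₁ * x + a₂ * y + a₃ * z) * (q * u - r * t)
    ≡ (p * (t * z - u * y) + r * (s * y - t * x) - q * (s * z - u * x)) * a₁
  first = solve-∀
  second : ∀ a₁ a₂ a₃ p q r s t u x y z →
    (a₁ * p + a₂ * q + a₃ * r) * (u * x - s * z) + (a₁ * s + a₂ * t + a₃ * u) * (z * p - x * r)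
      + (a₁ * x + a₂ * y + a₃ * z) * (r * s - p * u)
    ≡ (p * (t * z - u * y) + r * (s * y - t * x) - q * (s * z - u * x)) * a₂
  second = solve-∀
  third : ∀ a₁ a₂ a₃ p q r s t u x y z →
    (a₁ * p + a₂ * q + a₃ * r) * (s * y - t * x) + (a₁ * s + a₂ * t + a₃ * u) * (x * q - y * p)
      + (a₁ * x + a₂ * y + a₃ * z) * (p * t - q * s)
    ≡ (p * (t * z - u * y) + r * (s * y - t * x) - q * (s * z - u * x)) * a₃
  third = solve-∀

module _ (v₁ v₂ v₃ : Vℤ) (nc : NonCoplanar v₁ v₂ v₃) where
  private instance
    det≢0 : NonZero (det v₁ v₂ v₃)
    det≢0 = ℤ.≢-nonZero nc

  cramer : Vℤ → Vℤ
  cramer (c₁ , c₂ , c₃) = (c₁ ⊛ v₂ ⨯ v₃ ⊕ c₂ ⊛ v₃ ⨯ v₁ ⊕ c₃ ⊛ v₁ ⨯ v₂) ⊘ det v₁ v₂ v₃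

  cramer-∙ : ∀ a → cramer (a ∙ v₁ , a ∙ v₂ , a ∙ v₃) ≡ a
  cramer-∙ a = trans (cong (_⊘ det v₁ v₂ v₃) (cross-expansion a v₁ v₂ v₃))
                     (⊛-⊘-cancel (det v₁ v₂ v₃) a)

det-zero₂ : ∀ u w → det u 0ℤ³ w ≡ 0ℤ
det-zero₂ (p , q , r) _ rewrite ℤₚ.*-zeroʳ p | ℤₚ.*-zeroʳ q | ℤₚ.*-zeroʳ r = refl

det-zero₃ : ∀ u v → det u v 0ℤ³ ≡ 0ℤ
det-zero₃ (p , q , r) (s , t , u)
  rewrite ℤₚ.*-zeroʳ s | ℤₚ.*-zeroʳ t | ℤₚ.*-zeroʳ u
        | ℤₚ.*-zeroʳ p | ℤₚ.*-zeroʳ q | ℤₚ.*-zeroʳ r = refl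

0ℚ³ : Vℚ
0ℚ³ = (0ℚ , 0ℚ , 0ℚ)

·ᵥ-zeroˡ : ∀ x → 0ℚ ·ᵥ x ≡ 0ℚ³
·ᵥ-zeroˡ (x , y , z) rewrite ℚₚ.*-zeroˡ x | ℚₚ.*-zeroˡ y | ℚₚ.*-zeroˡ z = refl

·ᵥ-identityˡ : ∀ x → 1ℚ ·ᵥ x ≡ x
·ᵥ-identityˡ (x , y , z) rewrite ℚₚ.*-identityˡ x | ℚₚ.*-identityˡ y | ℚₚ.*-identityˡ z = refl

+ᵥ-identityˡ : ∀ x → 0ℚ³ +ᵥ x ≡ x
+ᵥ-identityˡ (x , y , z) rewrite ℚₚ.+-identityˡ x | ℚₚ.+-identityˡ y | ℚₚ.+-identityˡ z = refl

+ᵥ-identityʳ : ∀ x → x +ᵥ 0ℚ³ ≡ x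
+ᵥ-identityʳ (x , y , z) rewrite ℚₚ.+-identityʳ x | ℚₚ.+-identityʳ y | ℚₚ.+-identityʳ z = refl

dot-·ᵥ : ∀ a t x → dot a (t ·ᵥ x) ≡ t ℚ.* dot a x
dot-·ᵥ (a₁ , a₂ , a₃) t (x₁ , x₂ , x₃) =
  ℚ-Solver.+-*-Solver.solve 7
    (λ a₁ a₂ a₃ t x₁ x₂ x₃ → a₁ :* (t :* x₁) :+ a₂ :* (t :* x₂) :+ a₃ :* (t :* x₃)
                          := t :* (a₁ :* x₁ :+ a₂ :* x₂ :+ a₃ :* x₃))
    refl (fromℤ a₁) (fromℤ a₂) (fromℤ a₃) t x₁ x₂ x₃
  where open ℚ-Solver.+-*-Solver using (_:+_; _:*_; _:=_)

dot-toℚ : ∀ a v → dot a (toℚ v) ≡ fromℤ (a ∙ v)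
dot-toℚ (a₁ , a₂ , a₃) (p , q , r) = sym (begin
  fromℤ (a₁ * p + a₂ * q + a₃ * r)
    ≡⟨ fromℤ-+ (a₁ * p + a₂ * q) (a₃ * r) ⟩
  fromℤ (a₁ * p + a₂ * q) ℚ.+ fromℤ (a₃ * r)
    ≡⟨ cong (ℚ._+ fromℤ (a₃ * r)) (fromℤ-+ (a₁ * p) (a₂ * q)) ⟩
  fromℤ (a₁ * p) ℚ.+ fromℤ (a₂ * q) ℚ.+ fromℤ (a₃ * r)
    ≡⟨ cong₂ ℚ._+_ (cong₂ ℚ._+_ (fromℤ-* a₁ p) (fromℤ-* a₂ q)) (fromℤ-* a₃ r) ⟩
  fromℤ a₁ ℚ.* fromℤ p ℚ.+ fromℤ a₂ ℚ.* fromℤ q ℚ.+ fromℤ a₃ ℚ.* fromℤ r ∎)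
  where open ≡-Reasoning

dot-0ℚ³ : ∀ a → dot a 0ℚ³ ≡ 0ℚ
dot-0ℚ³ (a₁ , a₂ , a₃)
  rewrite ℚₚ.*-zeroʳ (fromℤ a₁) | ℚₚ.*-zeroʳ (fromℤ a₂) | ℚₚ.*-zeroʳ (fromℤ a₃) = refl

bounded-multiples⇒zero : ∀ M p → (∀ k → ℚ.∣ fromℤ (+ k) ℚ.* fromℤ p ∣ ℚ.≤ M) → p ≡ 0ℤ
bounded-multiples⇒zero M p bounded with p ℤ.≟ 0ℤ
... | yes p≡0 = p≡0
... | no p≢0 = ⊥-elim (ℚₚ.<-irrefl refl (begin-strict
  fromℤ (+ N)                     ≤⟨ fromℤ-mono-≤ (+≤+ N≤∣Np∣) ⟩
  fromℤ (+ ∣ + N * p ∣)            ≡⟨ sym (∣fromℤ∣ (+ N * p)) ⟩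
  ℚ.∣ fromℤ (+ N * p) ∣            ≡⟨ cong ℚ.∣_∣ (fromℤ-* (+ N) p) ⟩
  ℚ.∣ fromℤ (+ N) ℚ.* fromℤ p ∣    ≤⟨ bounded N ⟩
  M                               <⟨ archimedean M ⟩
  fromℤ (+ N)                     ∎))
  where
  open ℚₚ.≤-Reasoning
  N = suc ∣ ℚ.↥ M ∣
  N≤∣Np∣ : N ≤ ∣ + N * p ∣
  N≤∣Np∣ = subst (N ≤_) (sym (ℤₚ.abs-* (+ N) p)) (ℕₚ.m≤m*n N ∣ p ∣ {{ℤ.≢-nonZero p≢0}})

bounded-ray⇒zero : ∀ {S} v → Bounded S → (∀ k → S (fromℤ (+ k) ·ᵥ toℚ v)) → v ≡ 0ℤ³
bounded-ray⇒zero (p , q , r) (M , bound) ray =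
  cong₂ _,_ (bounded-multiples⇒zero M p (proj₁ ∘ along))
    (cong₂ _,_ (bounded-multiples⇒zero M q (proj₁ ∘ proj₂ ∘ along))
               (bounded-multiples⇒zero M r (proj₂ ∘ proj₂ ∘ along)))
  where along = λ k → bound _ (ray k)

∣c∣≤∣b∣-from-below : ∀ {b c} → 0ℤ ℤ.≤ b → c ℤ.≤ b → ¬ (∀ k → + k * c ℤ.≤ b) → ∣ c ∣ ≤ ∣ b ∣
∣c∣≤∣b∣-from-below {c = + n}      _   (+≤+ n≤m) _       = n≤m
∣c∣≤∣b∣-from-below {c = -[1+ n ]} 0≤b _         escapes = ⊥-elim (escapes λ k →
  ℤₚ.≤-trans (ℤₚ.≤-trans (ℤₚ.*-monoˡ-≤-nonNeg (+ k) (-≤+ {n} {0})) (ℤₚ.≤-reflexive (ℤₚ.*-zeroʳ (+ k)))) 0≤b)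

∣c∣≤∣b∣-from-above : ∀ {b c} → b ℤ.≤ 0ℤ → b ℤ.≤ c → ¬ (∀ k → b ℤ.≤ + k * c) → ∣ c ∣ ≤ ∣ b ∣
∣c∣≤∣b∣-from-above {c = -[1+ n ]} _   (-≤- n≤m) _       = s≤s n≤m
∣c∣≤∣b∣-from-above {c = + n}      b≤0 _         escapes = ⊥-elim (escapes λ k →
  ℤₚ.≤-trans b≤0 (subst (0ℤ ℤ.≤_) (ℤₚ.pos-* k n) (+≤+ z≤n)))

module Pyramid (v₁ v₂ v₃ : Vℤ) where

  combination : ℚ → ℚ → ℚ → Vℚ
  combination l₁ l₂ l₃ = ((l₁ ·ᵥ toℚ v₁) +ᵥ (l₂ ·ᵥ toℚ v₂)) +ᵥ (l₃ ·ᵥ toℚ v₃)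

  record Edge (v : Vℤ) : Set where
    field
      nonzero        : v ≢ 0ℤ³
      ray⊆cone       : ∀ t → 0ℚ ℚ.≤ t → InCone v₁ v₂ v₃ (t ·ᵥ toℚ v)
      vertex∈pyramid : InPyramid v₁ v₂ v₃ (toℚ v)

  origin∈pyramid : InPyramid v₁ v₂ v₃ 0ℚ³
  origin∈pyramid = 0ℚ , 0ℚ , 0ℚ , ℚₚ.≤-refl , ℚₚ.≤-refl , ℚₚ.≤-refl , 0ℚ≤1ℚ ,
    sym (cong₂ _+ᵥ_ (cong₂ _+ᵥ_ (·ᵥ-zeroˡ (toℚ v₁)) (·ᵥ-zeroˡ (toℚ v₂))) (·ᵥ-zeroˡ (toℚ v₃)))

  module _ (nc : NonCoplanar v₁ v₂ v₃) where
    edge₁ : Edge v₁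
    edge₁ = record
      { nonzero        = λ { refl → nc refl }
      ; ray⊆cone       = λ t 0≤t → t , 0ℚ , 0ℚ , 0≤t , ℚₚ.≤-refl , ℚₚ.≤-refl , sym (on-edge t)
      ; vertex∈pyramid = 1ℚ , 0ℚ , 0ℚ , 0ℚ≤1ℚ , ℚₚ.≤-refl , ℚₚ.≤-refl , ℚₚ.≤-refl ,
                         sym (trans (on-edge 1ℚ) (·ᵥ-identityˡ (toℚ v₁)))
      }
      where
      on-edge : ∀ t → combination t 0ℚ 0ℚ ≡ t ·ᵥ toℚ v₁
      on-edge t = begin
        ((t ·ᵥ toℚ v₁) +ᵥ (0ℚ ·ᵥ toℚ v₂)) +ᵥ (0ℚ ·ᵥ toℚ v₃)
          ≡⟨ cong₂ (λ x y → ((t ·ᵥ toℚ v₁) +ᵥ x) +ᵥ y) (·ᵥ-zeroˡ (toℚ v₂)) (·ᵥ-zeroˡ (toℚ v₃)) ⟩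
        ((t ·ᵥ toℚ v₁) +ᵥ 0ℚ³) +ᵥ 0ℚ³
          ≡⟨ trans (+ᵥ-identityʳ _) (+ᵥ-identityʳ _) ⟩
        t ·ᵥ toℚ v₁ ∎
        where open ≡-Reasoning

    edge₂ : Edge v₂
    edge₂ = record
      { nonzero        = λ { refl → nc (det-zero₂ v₁ v₃) }
      ; ray⊆cone       = λ t 0≤t → 0ℚ , t , 0ℚ , ℚₚ.≤-refl , 0≤t , ℚₚ.≤-refl , sym (on-edge t)
      ; vertex∈pyramid = 0ℚ , 1ℚ , 0ℚ , ℚₚ.≤-refl , 0ℚ≤1ℚ , ℚₚ.≤-refl , ℚₚ.≤-refl ,
                         sym (trans (on-edge 1ℚ) (·ᵥ-identityˡ (toℚ v₂)))
      }
      where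
      on-edge : ∀ t → combination 0ℚ t 0ℚ ≡ t ·ᵥ toℚ v₂
      on-edge t = begin
        ((0ℚ ·ᵥ toℚ v₁) +ᵥ (t ·ᵥ toℚ v₂)) +ᵥ (0ℚ ·ᵥ toℚ v₃)
          ≡⟨ cong₂ (λ x y → (x +ᵥ (t ·ᵥ toℚ v₂)) +ᵥ y) (·ᵥ-zeroˡ (toℚ v₁)) (·ᵥ-zeroˡ (toℚ v₃)) ⟩
        (0ℚ³ +ᵥ (t ·ᵥ toℚ v₂)) +ᵥ 0ℚ³
          ≡⟨ trans (+ᵥ-identityʳ _) (+ᵥ-identityˡ _) ⟩
        t ·ᵥ toℚ v₂ ∎
        where open ≡-Reasoning

    edge₃ : Edge v₃
    edge₃ = record
      { nonzero        = λ { refl → nc (det-zero₃ v₁ v₂) }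
      ; ray⊆cone       = λ t 0≤t → 0ℚ , 0ℚ , t , ℚₚ.≤-refl , ℚₚ.≤-refl , 0≤t , sym (on-edge t)
      ; vertex∈pyramid = 0ℚ , 0ℚ , 1ℚ , ℚₚ.≤-refl , ℚₚ.≤-refl , 0ℚ≤1ℚ , ℚₚ.≤-refl ,
                         sym (trans (on-edge 1ℚ) (·ᵥ-identityˡ (toℚ v₃)))
      }
      where
      on-edge : ∀ t → combination 0ℚ 0ℚ t ≡ t ·ᵥ toℚ v₃
      on-edge t = begin
        ((0ℚ ·ᵥ toℚ v₁) +ᵥ (0ℚ ·ᵥ toℚ v₂)) +ᵥ (t ·ᵥ toℚ v₃)
          ≡⟨ cong₂ (λ x y → (x +ᵥ y) +ᵥ (t ·ᵥ toℚ v₃)) (·ᵥ-zeroˡ (toℚ v₁)) (·ᵥ-zeroˡ (toℚ v₂)) ⟩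
        (0ℚ³ +ᵥ 0ℚ³) +ᵥ (t ·ᵥ toℚ v₃)
          ≡⟨ +ᵥ-identityˡ _ ⟩
        t ·ᵥ toℚ v₃ ∎
        where open ≡-Reasoning

  HalfCone : Vℤ → (ℚ → Set) → Vℚ → Set
  HalfCone a side x = InCone v₁ v₂ v₃ x × side (dot a x)

  module BoundedHalfCone (a : Vℤ) (side : ℚ → Set) (bounded : Bounded (HalfCone a side))
                         (P⊆H : InPyramid v₁ v₂ v₃ ⊆ HalfCone a side) where

    origin-side : side 0ℚ
    origin-side = subst side (dot-0ℚ³ a) (proj₂ (P⊆H _ origin∈pyramid))

    vertex-side : ∀ {v} → Edge v → side (fromℤ (a ∙ v))
    vertex-side e = subst side (dot-toℚ a _) (proj₂ (P⊆H _ (Edge.vertex∈pyramid e)))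

    ray-leaves : ∀ {v} → Edge v → ¬ (∀ k → side (fromℤ (+ k * a ∙ v)))
    ray-leaves {v} e inside = Edge.nonzero e (bounded-ray⇒zero v bounded λ k →
      Edge.ray⊆cone e (fromℤ (+ k)) (fromℤ-mono-≤ (+≤+ {n = k} z≤n)) ,
      subst side (sym (dot-ray k)) (inside k))
      where
      dot-ray : ∀ k → dot a (fromℤ (+ k) ·ᵥ toℚ v) ≡ fromℤ (+ k * a ∙ v)
      dot-ray k = begin
        dot a (fromℤ (+ k) ·ᵥ toℚ v)     ≡⟨ dot-·ᵥ a (fromℤ (+ k)) (toℚ v) ⟩
        fromℤ (+ k) ℚ.* dot a (toℚ v)    ≡⟨ cong (fromℤ (+ k) ℚ.*_) (dot-toℚ a v) ⟩
        fromℤ (+ k) ℚ.* fromℤ (a ∙ v)    ≡⟨ sym (fromℤ-* (+ k) (a ∙ v)) ⟩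
        fromℤ (+ k * a ∙ v)              ∎
        where open ≡-Reasoning

  cut⇒∣a∙v∣≤∣b∣ : ∀ {v} a b → CutsOffPyramid v₁ v₂ v₃ a b → Edge v → ∣ a ∙ v ∣ ≤ ∣ b ∣
  cut⇒∣a∙v∣≤∣b∣ {v} a b (_ , _ , inj₁ (bounded , P⊆H)) e =
    ∣c∣≤∣b∣-from-below {b} {a ∙ v} (fromℤ-cancel-≤ origin-side) (fromℤ-cancel-≤ (vertex-side e))
      (λ below → ray-leaves e (fromℤ-mono-≤ ∘ below))
    where open BoundedHalfCone a (ℚ._≤ fromℤ b) bounded P⊆H
  cut⇒∣a∙v∣≤∣b∣ {v} a b (_ , _ , inj₂ (bounded , P⊆H)) e =
    ∣c∣≤∣b∣-from-above {b} {a ∙ v} (fromℤ-cancel-≤ origin-side) (fromℤ-cancel-≤ (vertex-side e))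
      (λ above → ray-leaves e (fromℤ-mono-≤ ∘ above))
    where open BoundedHalfCone a (fromℤ b ℚ.≤_) bounded P⊆H

ball : ℕ → List ℤ
ball d = map +_ (upTo (suc d)) ++ map (λ n → - + n) (upTo (suc d))

∈-ball : ∀ {d} i → ∣ i ∣ ≤ d → i ∈ ball d
∈-ball (+ n)          n≤d  = ∈-++⁺ˡ (∈-map⁺ +_ (∈-upTo⁺ (s≤s n≤d)))
∈-ball {d} -[1+ n ] 1+n≤d = ∈-++⁺ʳ (map +_ (upTo (suc d))) (∈-map⁺ (λ n → - + n) (∈-upTo⁺ (s≤s 1+n≤d)))

box : ℕ → List Vℤ
box d = cartesianProduct (ball d) (cartesianProduct (ball d) (ball d))

∈-box : ∀ {d} x y z → ∣ x ∣ ≤ d → ∣ y ∣ ≤ d → ∣ z ∣ ≤ d → (x , y , z) ∈ box d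
∈-box x y z x≤d y≤d z≤d =
  ∈-cartesianProduct⁺ (∈-ball x x≤d) (∈-cartesianProduct⁺ (∈-ball y y≤d) (∈-ball z z≤d))

proposition3p1 : (v₁ v₂ v₃ : Vℤ) → NonCoplanar v₁ v₂ v₃ → (d : ℕ) →
    ∃[ L ] (∀ (a : Vℤ) (b : ℤ) → Primitive a → IntDistO a b ≤ d →
      CutsOffPyramid v₁ v₂ v₃ a b → (a , b) ∈ L)
proposition3p1 v₁ v₂ v₃ nc d = candidates , cut⇒∈candidates
  where
  open Pyramid v₁ v₂ v₃
  plane : Vℤ × ℤ → Vℤ × ℤ
  plane (c , b) = cramer v₁ v₂ v₃ nc c , b
  candidates : List (Vℤ × ℤ)
  candidates = map plane (cartesianProduct (box d) (ball d))
  cut⇒∈candidates : ∀ a b → Primitive a → ∣ b ∣ ≤ d → CutsOffPyramid v₁ v₂ v₃ a b →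
                    (a , b) ∈ candidates
  cut⇒∈candidates a b _ ∣b∣≤d cut =
    subst (_∈ candidates) (cong (_, b) (cramer-∙ v₁ v₂ v₃ nc a))
      (∈-map⁺ plane (∈-cartesianProduct⁺
        (∈-box (a ∙ v₁) (a ∙ v₂) (a ∙ v₃) (≤d (edge₁ nc)) (≤d (edge₂ nc)) (≤d (edge₃ nc)))
        (∈-ball b ∣b∣≤d)))
    where
    ≤d : ∀ {v} → Edge v → ∣ a ∙ v ∣ ≤ d
    ≤d e = ℕₚ.≤-trans (cut⇒∣a∙v∣≤∣b∣ a b cut e) ∣b∣≤d
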